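{- Let $G_2$ be the graph with vertices $u,v,w,x,y$ and edges $uv,uw,vw,vx,wy$. If $\varphi$ is a conflict-free incidence coloring of $G_2$ using at most $6$ colors, then $\{\varphi(v,vx),\varphi(x,vx)\}\cap\{\varphi(w,wy),\varphi(y,wy)\}=\emptyset$.
   Context: An incidence of a graph is a pair $(a,e)$ with $a$ an endpoint of the edge $e$; for a vertex $c$, $I(c)$ is the set of incidences $(b,e)$ with $e$ incident with $c$; two incidences conflict if both lie in some $I(c)$; a conflict-free incidence coloring assigns colors to incidences so that conflicting incidences get distinct colors. -}

module Defs where

open import Data.Fin using (Fin)
open import Data.Product using (Σ; ∃; _×_; _,_)
open import Data.Sum using (_⊎_)
open import Relation.Binary.PropositionalEquality using (_≡_)
open import Relation.Nullary using (¬_)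

record Graph : Set₁ where
  field
    V  : Set
    E  : Set
    end₁ : E → V
    end₂ : E → V

module _ (G : Graph) where
  open Graph G

  IsEnd : V → E → Set
  IsEnd a e = (a ≡ end₁ e) ⊎ (a ≡ end₂ e)

  Incidence : Set
  Incidence = Σ V λ a → Σ E λ e → IsEnd a e

  incV : Incidence → V
  incV (a , _ , _) = a

  incE : Incidence → E
  incE (_ , e , _) = e

  InI : V → Incidence → Set
  InI c i = IsEnd c (incE i)

  Conflict : Incidence → Incidence → Set
  Conflict i j = ∃ λ c → InI c i × InI c j

  -- identity of incidences (vertex and edge); the endpoint proof is irrelevant
  SameInc : Incidence → Incidence → Set
  SameInc i j = (incV i ≡ incV j) × (incE i ≡ incE j)

  ConflictFree : {C : Set} → (Incidence → C) → Set
  ConflictFree φ = ∀ i j → ¬ SameInc i j → Conflict i j → ¬ (φ i ≡ φ j)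

data V₂ : Set where
  u v w x y : V₂

data E₂ : Set where
  uv uw vw vx wy : E₂

e₁ : E₂ → V₂
e₁ uv = u
e₁ uw = u
e₁ vw = v
e₁ vx = v
e₁ wy = w

e₂ : E₂ → V₂
e₂ uv = v
e₂ uw = w
e₂ vw = w
e₂ vx = x
e₂ wy = y

G₂ : Graph
G₂ = record { V = V₂ ; E = E₂ ; end₁ = e₁ ; end₂ = e₂ }

open import Data.Sum using (inj₁; inj₂)
open import Relation.Binary.PropositionalEquality using (refl)

i-v-vx i-x-vx i-w-wy i-y-wy : Incidence G₂
i-v-vx = v , vx , inj₁ refl
i-x-vx = x , vx , inj₂ refl
i-w-wy = w , wy , inj₁ refl
i-y-wy = y , wy , inj₂ refl

{-# OPTIONS --safe #-}
-- The six incidences of the triangle uvw pairwise conflict, since any two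
-- edges of a triangle share a vertex, so they receive six distinct colours and
-- thus use up all of Fin 6.  A colour a occurring on vx and on wy would then be
-- the colour of some triangle incidence; but every triangle edge passes through
-- v (and then conflicts with vx) or through w (and then conflicts with wy).
module Submission where

open import Defs
open import Data.Fin using (Fin; zero; suc)
open import Data.Fin.Properties using (pigeonhole; _≟_; <⇒≢)
open import Data.Nat.Properties using (≤-refl)
open import Data.Vec.Functional using (_∷_)
open import Data.Product using (∃; _×_; _,_; proj₂)
open import Data.Empty using (⊥)
open import Data.Sum using (_⊎_; inj₁; inj₂; [_,_])
open import Function using (_∘_)
open import Function.Definitions using (Injective)
open import Relation.Binary.PropositionalEquality
  using (_≡_; _≢_; refl; sym; trans; cong; cong₂; module ≡-Reasoning)
open import Relation.Nullary using (¬_; yes; no; contradiction)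

injective⇒¬misses : ∀ {n} (f : Fin n → Fin n) → Injective _≡_ _≡_ f →
                    ∀ a → ¬ (∀ i → f i ≢ a)
injective⇒¬misses f f-inj a misses with pigeonhole ≤-refl (a ∷ f)
... | zero  , suc j , _   , a≡fj  = misses j (sym a≡fj)
... | suc i , suc j , i<j , fi≡fj = <⇒≢ i<j (cong suc (f-inj fi≡fj))

module _ (G : Graph) {C : Set} {φ : Incidence G → C} (φ-cf : ConflictFree G φ) where

  conflict-free⇒injective-on-clique :
    ∀ {n} (t : Fin n → Incidence G) →
    (∀ i j → SameInc G (t i) (t j) → i ≡ j) →
    (∀ i j → Conflict G (t i) (t j)) →
    Injective _≡_ _≡_ (φ ∘ t)
  conflict-free⇒injective-on-clique t t-distinct t-conflict {i} {j} φti≡φtj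
    with i ≟ j
  ... | yes i≡j = i≡j
  ... | no  i≢j = contradiction φti≡φtj
                    (φ-cf (t i) (t j) (i≢j ∘ t-distinct i j) (t-conflict i j))

  conflict-free-at-vertex : ∀ {c s t} → InI G c s → InI G c t →
                            incE G s ≢ incE G t → φ s ≢ φ t
  conflict-free-at-vertex {c} {s} {t} s∈Ic t∈Ic s≢t =
    φ-cf s t (s≢t ∘ proj₂) (c , s∈Ic , t∈Ic)

data TriangleEdge : E₂ → Set where
  uv-triangle : TriangleEdge uv
  uw-triangle : TriangleEdge uw
  vw-triangle : TriangleEdge vw

triangle-edges-meet : ∀ {e f} → TriangleEdge e → TriangleEdge f →
                      ∃ λ c → IsEnd G₂ c e × IsEnd G₂ c f
triangle-edges-meet uv-triangle uv-triangle = u , inj₁ refl , inj₁ refl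
triangle-edges-meet uv-triangle uw-triangle = u , inj₁ refl , inj₁ refl
triangle-edges-meet uv-triangle vw-triangle = v , inj₂ refl , inj₁ refl
triangle-edges-meet uw-triangle uv-triangle = u , inj₁ refl , inj₁ refl
triangle-edges-meet uw-triangle uw-triangle = u , inj₁ refl , inj₁ refl
triangle-edges-meet uw-triangle vw-triangle = w , inj₂ refl , inj₂ refl
triangle-edges-meet vw-triangle uv-triangle = v , inj₁ refl , inj₂ refl
triangle-edges-meet vw-triangle uw-triangle = w , inj₂ refl , inj₂ refl
triangle-edges-meet vw-triangle vw-triangle = v , inj₁ refl , inj₁ refl

triangle-edge-through-v-or-w : ∀ {e} → TriangleEdge e →
  (IsEnd G₂ v e × e ≢ vx) ⊎ (IsEnd G₂ w e × e ≢ wy)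
triangle-edge-through-v-or-w uv-triangle = inj₁ (inj₂ refl , λ ())
triangle-edge-through-v-or-w uw-triangle = inj₂ (inj₂ refl , λ ())
triangle-edge-through-v-or-w vw-triangle = inj₁ (inj₁ refl , λ ())

triangle : Fin 6 → Incidence G₂
triangle zero                               = u , uv , inj₁ refl
triangle (suc zero)                         = v , uv , inj₂ refl
triangle (suc (suc zero))                   = u , uw , inj₁ refl
triangle (suc (suc (suc zero)))             = w , uw , inj₂ refl
triangle (suc (suc (suc (suc zero))))       = v , vw , inj₁ refl
triangle (suc (suc (suc (suc (suc zero))))) = w , vw , inj₂ refl

triangle-edge : ∀ k → TriangleEdge (incE G₂ (triangle k))
triangle-edge zero                               = uv-triangle
triangle-edge (suc zero)                         = uv-triangle
triangle-edge (suc (suc zero))                   = uw-triangle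
triangle-edge (suc (suc (suc zero)))             = uw-triangle
triangle-edge (suc (suc (suc (suc zero))))       = vw-triangle
triangle-edge (suc (suc (suc (suc (suc zero))))) = vw-triangle

-- A left inverse of triangle; its value off the triangle is arbitrary.
triangle-position : V₂ → E₂ → Fin 6
triangle-position u uv = zero
triangle-position v uv = suc zero
triangle-position u uw = suc (suc zero)
triangle-position w uw = suc (suc (suc zero))
triangle-position v vw = suc (suc (suc (suc zero)))
triangle-position w vw = suc (suc (suc (suc (suc zero))))
triangle-position _ _  = zero

triangle-position-triangle : ∀ k →
  triangle-position (incV G₂ (triangle k)) (incE G₂ (triangle k)) ≡ k
triangle-position-triangle zero                               = refl
triangle-position-triangle (suc zero)                         = refl
triangle-position-triangle (suc (suc zero))                   = refl
triangle-position-triangle (suc (suc (suc zero)))             = refl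
triangle-position-triangle (suc (suc (suc (suc zero))))       = refl
triangle-position-triangle (suc (suc (suc (suc (suc zero))))) = refl

triangle-distinct : ∀ i j → SameInc G₂ (triangle i) (triangle j) → i ≡ j
triangle-distinct i j (vertices≡ , edges≡) = begin
  i                                                                ≡⟨ sym (triangle-position-triangle i) ⟩
  triangle-position (incV G₂ (triangle i)) (incE G₂ (triangle i)) ≡⟨ cong₂ triangle-position vertices≡ edges≡ ⟩
  triangle-position (incV G₂ (triangle j)) (incE G₂ (triangle j)) ≡⟨ triangle-position-triangle j ⟩
  j                                                                ∎
  where open ≡-Reasoning

triangle-conflict : ∀ i j → Conflict G₂ (triangle i) (triangle j)
triangle-conflict i j = triangle-edges-meet (triangle-edge i) (triangle-edge j)

lemma3p4 : (φ : Incidence G₂ → Fin 6) → ConflictFree G₂ φ →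
    (a : Fin 6) →
    (a ≡ φ i-v-vx ⊎ a ≡ φ i-x-vx) → (a ≡ φ i-w-wy ⊎ a ≡ φ i-y-wy) → ⊥
lemma3p4 φ φ-cf a a-on-vx a-on-wy =
  injective⇒¬misses (φ ∘ triangle)
    (conflict-free⇒injective-on-clique G₂ φ-cf triangle triangle-distinct triangle-conflict)
    a triangle-misses-a
  where
  avoids : ∀ {c} t p → InI G₂ c t → InI G₂ c p → incE G₂ t ≢ incE G₂ p →
           a ≡ φ p → φ t ≢ a
  avoids t p t∈Ic p∈Ic t≢p a≡φp φt≡a =
    conflict-free-at-vertex G₂ φ-cf t∈Ic p∈Ic t≢p (trans φt≡a a≡φp)

  triangle-misses-a : ∀ k → φ (triangle k) ≢ a
  triangle-misses-a k with triangle-edge-through-v-or-w (triangle-edge k)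
  ... | inj₁ (at-v , ≢vx) =
    [ avoids (triangle k) i-v-vx at-v (inj₁ refl) ≢vx
    , avoids (triangle k) i-x-vx at-v (inj₁ refl) ≢vx ] a-on-vx
  ... | inj₂ (at-w , ≢wy) =
    [ avoids (triangle k) i-w-wy at-w (inj₁ refl) ≢wy
    , avoids (triangle k) i-y-wy at-w (inj₁ refl) ≢wy ] a-on-wy
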